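{- Let $j,n$ be positive integers with $n\le 3j$. Every partition $\mu\in\mathcal{PM}(n,j)$ can be written as $\mu=(\mu_1,\mu_2,\ldots,\mu_k,1^{j-1})$ with $\mu_1\ge\cdots\ge\mu_k\ge 2$. The map $$\phi:\mathcal{PM}(n,j)\to\{\lambda\in\mathcal{PM}(n+2,j+1): \lambda_1\neq\lambda_2\}$$ defined by $(\mu_1,\mu_2,\ldots,\mu_k,1^{j-1})\mapsto(\mu_1+1,\mu_2,\ldots,\mu_k,1^{j})$ is well defined and bijective.
   Context: A partition $\lambda=(\lambda_1\ge\cdots\ge\lambda_\ell)$ of $n$ is a finite nonincreasing sequence of positive integers with sum $n$; $\ell(\lambda)$ is its number of parts; $1^{r}$ denotes $r$ parts equal to $1$. The hook length $h_{(i,j)}(\lambda)$ of a cell $(i,j)$ of the Ferrers diagram is the number of cells consisting of the cell itself, the cells to its right in its row and the cells below it in its column. A numerical set is a subset $S\subseteq\mathbb{N}_0$ containing $0$ with finite complement; a numerical semigroup is a numerical set closed under addition. For a partition $\lambda$ let $S_\lambda=\mathbb{N}_0\setminus\{h_{(i,1)}(\lambda):1\le i\le\ell(\lambda)\}$. $\mathcal{PM}(n,m)$ is the set of partitions $\lambda$ of $n$ having exactly $m-1$ parts equal to $1$ such that $S_\lambda$ is a numerical semigroup. -}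

module Defs where

open import Data.Nat using (ℕ; zero; suc; _+_; _≤_; _<_; _≥_; _∸_; _≤?_; _≟_)
open import Data.Nat.ListAction using (sum)
open import Data.List using (List; []; _∷_; length; filter; replicate; _++_)
open import Data.List.Relation.Unary.All using (All)
open import Data.List.Relation.Unary.Linked using (Linked)
open import Data.List.Membership.Propositional using (_∉_)
open import Data.Product using (_×_; ∃)
open import Relation.Binary.PropositionalEquality using (_≡_; _≢_)

IsPartition : ℕ → List ℕ → Set
IsPartition n λ' = Linked _≥_ λ' × All (1 ≤_) λ' × sum λ' ≡ n

-- Hook lengths of the first-column cells (i,1), i = 1..ℓ(λ):
-- h_(i,1) = 1 + (λ_i - 1) [arm] + (ℓ - i) [leg] = λ_i + (ℓ - i).
firstColHooks : List ℕ → List ℕ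
firstColHooks []       = []
firstColHooks (x ∷ xs) = (x + length xs) ∷ firstColHooks xs

Sλ : List ℕ → ℕ → Set
Sλ λ' a = a ∉ firstColHooks λ'

IsNumericalSet : (ℕ → Set) → Set
IsNumericalSet S = S 0 × ∃ (λ N → ∀ m → N ≤ m → S m)

IsNumericalSemigroup : (ℕ → Set) → Set
IsNumericalSemigroup S = IsNumericalSet S × (∀ a b → S a → S b → S (a + b))

ones : List ℕ → ℕ
ones λ' = length (filter (_≟ 1) λ')

PM : ℕ → ℕ → List ℕ → Set
PM n m λ' = IsPartition n λ' × ones λ' ≡ m ∸ 1 × IsNumericalSemigroup (Sλ λ')

-- λ_i with the usual convention λ_i = 0 for i > ℓ(λ)
part : List ℕ → ℕ → ℕ
part []       _       = 0
part (x ∷ _)  zero    = x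
part (_ ∷ xs) (suc i) = part xs i

Target : ℕ → ℕ → List ℕ → Set
Target n j λ' = PM (n + 2) (suc j) λ' × part λ' 0 ≢ part λ' 1

bumpFirst : List ℕ → List ℕ
bumpFirst []       = []
bumpFirst (x ∷ xs) = suc x ∷ xs

φ : ℕ → List ℕ → List ℕ
φ j μ = bumpFirst (filter (2 ≤?_) μ) ++ replicate j 1

{-# OPTIONS --safe #-}
-- Write μ ∈ PM(n, j) as (x, ys, 1ʳ) with r = j - 1 and all of x, ys at least 2. Its
-- first-column hooks are 1, …, r, the shifts c + r of the hooks c of ys, and the top hook
-- x + |ys| + r. Twice a hook of ys is at most x + Σ ys, so n ≤ 3j forces c ≤ r + 1; as the
-- nonzero elements of S_μ are at least r + 1, a sum of two of them can only be a hook if it is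
-- the top hook. Hence S_μ is a semigroup iff every u, v with r + 2 + u + v = x + |ys| have
-- u + 1 or v + 1 among the hooks of ys. The map φ raises both x and r by one, which leaves this
-- condition unchanged; the condition λ₁ ≠ λ₂ is exactly what lets one lower x again.
module Submission where

open import Defs
open import Data.Nat using (ℕ; zero; suc; _+_; _*_; _∸_; _⊔_; _≤_; _<_; _≥_; _≤?_; _≟_; z≤n; s≤s)
open import Data.Nat.Properties
open import Data.Nat.ListAction using (sum)
open import Data.Nat.ListAction.Properties using (sum-++)
open import Data.Nat.Tactic.RingSolver using (solve-∀)
open import Data.List using (List; []; _∷_; _++_; length; filter; replicate; map; applyDownFrom)
open import Data.List.Properties using (filter-++; filter-all; filter-none; ++-identityʳ; ++-cancelʳ; length-++; length-replicate)
open import Data.List.Relation.Unary.All using (All; []; _∷_)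
import Data.List.Relation.Unary.All as All
open import Data.List.Relation.Unary.All.Properties using (replicate⁺) renaming (++⁺ to All-++⁺)
open import Data.List.Relation.Unary.Linked using (Linked; []; [-]; _∷_; tail)
open import Data.List.Relation.Unary.Any using (here; there)
open import Data.List.Membership.Propositional using (_∈_; _∉_)
open import Data.List.Membership.Propositional.Properties using (∈-map⁺; ∈-map⁻; ∈-++⁺ˡ; ∈-++⁺ʳ; ∈-++⁻; ∈-applyDownFrom⁺; ∈-applyDownFrom⁻)
open import Data.List.Membership.DecPropositional _≟_ using (_∈?_)
open import Data.Product using (_×_; Σ; ∃; ∃₂; _,_; proj₁; proj₂)
open import Data.Sum using (_⊎_; inj₁; inj₂)
open import Data.Empty using (⊥-elim)
open import Function using (_∘_)
open import Relation.Nullary using (¬_; yes; no)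
open import Relation.Binary.PropositionalEquality using (_≡_; _≢_; refl; sym; trans; cong; cong₂; subst; module ≡-Reasoning)

ComplementAdditive : (ℕ → Set) → Set
ComplementAdditive G = ∀ a b → ¬ G a → ¬ G b → ¬ G (a + b)

0∉firstColHooks : ∀ {L} → All (1 ≤_) L → 0 ∉ firstColHooks L
0∉firstColHooks (s≤s _ ∷ _)   (here ())
0∉firstColHooks (_ ∷ pos)     (there 0∈) = 0∉firstColHooks pos 0∈

eventually-∉ : (xs : List ℕ) → ∃ λ N → ∀ m → N ≤ m → m ∉ xs
eventually-∉ []       = 0 , λ _ _ ()
eventually-∉ (x ∷ xs) with eventually-∉ xs
... | N , beyond = suc x ⊔ N , λ m N′≤m → λ
  { (here m≡x)  → <-irrefl (sym m≡x) (≤-trans (m≤m⊔n (suc x) N) N′≤m)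
  ; (there m∈) → beyond m (≤-trans (m≤n⊔m (suc x) N) N′≤m) m∈
  }

additive⇒numericalSemigroup : ∀ {L} → All (1 ≤_) L →
  ComplementAdditive (_∈ firstColHooks L) → IsNumericalSemigroup (Sλ L)
additive⇒numericalSemigroup {L} pos closed =
  (0∉firstColHooks pos , eventually-∉ (firstColHooks L)) , closed

firstColHooks-++ : ∀ ys zs →
  firstColHooks (ys ++ zs) ≡ map (_+ length zs) (firstColHooks ys) ++ firstColHooks zs
firstColHooks-++ []       zs = refl
firstColHooks-++ (y ∷ ys) zs =
  cong₂ _∷_ (trans (cong (y +_) (length-++ ys)) (sym (+-assoc y (length ys) (length zs))))
            (firstColHooks-++ ys zs)

firstColHooks-replicate : ∀ r → firstColHooks (replicate r 1) ≡ applyDownFrom suc r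
firstColHooks-replicate zero    = refl
firstColHooks-replicate (suc r) =
  cong₂ _∷_ (cong suc (length-replicate r)) (firstColHooks-replicate r)

paddedHooks : ℕ → ℕ → List ℕ → List ℕ
paddedHooks r h K = h + r ∷ map (_+ r) K ++ applyDownFrom suc r

firstColHooks-padded : ∀ x ys r →
  firstColHooks ((x ∷ ys) ++ replicate r 1) ≡ paddedHooks r (x + length ys) (firstColHooks ys)
firstColHooks-padded x ys r = cong₂ _∷_ top rest
  where
  open ≡-Reasoning
  top : x + length (ys ++ replicate r 1) ≡ x + length ys + r
  top = begin
    x + length (ys ++ replicate r 1)           ≡⟨ cong (x +_) (length-++ ys) ⟩
    x + (length ys + length (replicate r 1))   ≡⟨ cong (λ k → x + (length ys + k)) (length-replicate r) ⟩
    x + (length ys + r)                        ≡⟨ sym (+-assoc x (length ys) r) ⟩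
    x + length ys + r                          ∎
  rest : firstColHooks (ys ++ replicate r 1) ≡ map (_+ r) (firstColHooks ys) ++ applyDownFrom suc r
  rest = begin
    firstColHooks (ys ++ replicate r 1)
      ≡⟨ firstColHooks-++ ys (replicate r 1) ⟩
    map (_+ length (replicate r 1)) (firstColHooks ys) ++ firstColHooks (replicate r 1)
      ≡⟨ cong₂ (λ k L → map (_+ k) (firstColHooks ys) ++ L) (length-replicate r) (firstColHooks-replicate r) ⟩
    map (_+ r) (firstColHooks ys) ++ applyDownFrom suc r
      ∎

SplitCovered : ℕ → ℕ → List ℕ → Set
SplitCovered r h K = ∀ u v → r + 2 + u + v ≡ h → suc u ∈ K ⊎ suc v ∈ K

splitCovered-suc : ∀ {r h K} → SplitCovered r h K → SplitCovered (suc r) (suc h) K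
splitCovered-suc covered u v = covered u v ∘ suc-injective

splitCovered-pred : ∀ {r h K} → SplitCovered (suc r) (suc h) K → SplitCovered r h K
splitCovered-pred covered u v = covered u v ∘ cong suc

shifted-sum : ∀ r u v → r + 2 + u + v + r ≡ suc r + u + (suc r + v)
shifted-sum = solve-∀

module PaddedHooks (r h : ℕ) (K : List ℕ) where

  ∈-paddedHooks⁻ : ∀ {a} → a ∈ paddedHooks r h K →
    a ≡ h + r ⊎ (∃ λ c → c ∈ K × a ≡ c + r) ⊎ (1 ≤ a × a ≤ r)
  ∈-paddedHooks⁻ (here a≡top) = inj₁ a≡top
  ∈-paddedHooks⁻ (there a∈) with ∈-++⁻ (map (_+ r) K) a∈
  ... | inj₁ a∈shifted = inj₂ (inj₁ (∈-map⁻ (_+ r) a∈shifted))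
  ... | inj₂ a∈small with ∈-applyDownFrom⁻ suc a∈small
  ...   | i , i<r , refl = inj₂ (inj₂ (s≤s z≤n , i<r))

  ∈-paddedHooks-small : ∀ {a} → 1 ≤ a → a ≤ r → a ∈ paddedHooks r h K
  ∈-paddedHooks-small (s≤s _) a≤r = there (∈-++⁺ʳ (map (_+ r) K) (∈-applyDownFrom⁺ suc a≤r))

  ∈-paddedHooks-shifted : ∀ {u} → suc u ∈ K → suc r + u ∈ paddedHooks r h K
  ∈-paddedHooks-shifted {u} u∈ =
    subst (_∈ paddedHooks r h K) (cong suc (+-comm u r)) (there (∈-++⁺ˡ (∈-map⁺ (_+ r) u∈)))

  ∉-paddedHooks-shifted : ∀ {u} → suc r + u < h + r → suc u ∉ K → suc r + u ∉ paddedHooks r h K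
  ∉-paddedHooks-shifted {u} below u∉ a∈ with ∈-paddedHooks⁻ a∈
  ... | inj₁ a≡top                 = <-irrefl a≡top below
  ... | inj₂ (inj₁ (c , c∈ , a≡c+r)) =
    u∉ (subst (_∈ K) (sym (+-cancelʳ-≡ r (suc u) c (trans (cong suc (+-comm u r)) a≡c+r))) c∈)
  ... | inj₂ (inj₂ (_ , a≤r))      = <-irrefl refl (≤-trans (m≤m+n (suc r) u) a≤r)

  ∉-paddedHooks⇒ : ∀ {a} → a ∉ paddedHooks r h K → a ≡ 0 ⊎ ∃ λ u → a ≡ suc r + u
  ∉-paddedHooks⇒ {zero}  _  = inj₁ refl
  ∉-paddedHooks⇒ {suc a} a∉ with suc a ≤? r
  ... | yes a≤r = ⊥-elim (a∉ (∈-paddedHooks-small (s≤s z≤n) a≤r))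
  ... | no  a≰r = inj₂ (suc a ∸ suc r , sym (m+[n∸m]≡n (≰⇒> a≰r)))

  additive⇒splitCovered : ComplementAdditive (_∈ paddedHooks r h K) → SplitCovered r h K
  additive⇒splitCovered closed u v split with suc u ∈? K | suc v ∈? K
  ... | yes u∈ | _      = inj₁ u∈
  ... | no _   | yes v∈ = inj₂ v∈
  ... | no u∉  | no v∉  =
    ⊥-elim (closed (suc r + u) (suc r + v)
      (∉-paddedHooks-shifted (m+n≤o⇒m≤o _ (≤-reflexive (trans (u-below r u v) top≡))) u∉)
      (∉-paddedHooks-shifted (m+n≤o⇒m≤o _ (≤-reflexive (trans (v-below r u v) top≡))) v∉)
      (subst (_∈ paddedHooks r h K) (trans (sym top≡) (shifted-sum r u v)) (here refl)))
    where
    top≡ : r + 2 + u + v + r ≡ h + r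
    top≡ = cong (_+ r) split
    u-below : ∀ r u v → suc (suc r + u) + (v + r) ≡ r + 2 + u + v + r
    u-below = solve-∀
    v-below : ∀ r u v → suc (suc r + v) + (u + r) ≡ r + 2 + u + v + r
    v-below = solve-∀

  splitCovered⇒additive : (∀ {c} → c ∈ K → c ≤ suc r) →
    SplitCovered r h K → ComplementAdditive (_∈ paddedHooks r h K)
  splitCovered⇒additive small covered a b a∉ b∉ ab∈
    with ∉-paddedHooks⇒ a∉ | ∉-paddedHooks⇒ b∉
  ... | inj₁ refl       | _         = b∉ ab∈
  ... | inj₂ _          | inj₁ refl = a∉ (subst (_∈ _) (+-identityʳ a) ab∈)
  ... | inj₂ (u , refl) | inj₂ (v , refl) with ∈-paddedHooks⁻ ab∈
  ...   | inj₁ ab≡top with covered u v (+-cancelʳ-≡ r _ _ (trans (shifted-sum r u v) ab≡top))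
  ...     | inj₁ u∈ = a∉ (∈-paddedHooks-shifted u∈)
  ...     | inj₂ v∈ = b∉ (∈-paddedHooks-shifted v∈)
  splitCovered⇒additive small covered a b a∉ b∉ ab∈
    | inj₂ (u , refl) | inj₂ (v , refl) | inj₂ (inj₁ (c , c∈ , ab≡c+r)) =
    <-irrefl refl (+-cancelˡ-≤ (suc r) (suc r) r (begin
      suc r + suc r             ≤⟨ +-mono-≤ (m≤m+n (suc r) u) (m≤m+n (suc r) v) ⟩
      suc r + u + (suc r + v)   ≡⟨ ab≡c+r ⟩
      c + r                     ≤⟨ +-monoˡ-≤ r (small c∈) ⟩
      suc r + r                 ∎))
    where open ≤-Reasoning
  splitCovered⇒additive small covered a b a∉ b∉ ab∈
    | inj₂ (u , refl) | inj₂ (v , refl) | inj₂ (inj₂ (_ , ab≤r)) =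
    <-irrefl refl (≤-trans (≤-trans (m≤m+n (suc r) u) (m≤m+n (suc r + u) (suc r + v))) ab≤r)

open PaddedHooks using (additive⇒splitCovered; splitCovered⇒additive)

length+length≤sum : ∀ {zs} → All (2 ≤_) zs → length zs + length zs ≤ sum zs
length+length≤sum []                  = z≤n
length+length≤sum {z ∷ zs} (2≤z ∷ ps) =
  subst (_≤ z + sum zs) (cong suc (sym (+-suc (length zs) (length zs))))
        (+-mono-≤ 2≤z (length+length≤sum ps))

hook+hook≤sum : ∀ {x ys c} → Linked _≥_ (x ∷ ys) → All (2 ≤_) ys →
  c ∈ firstColHooks ys → c + c ≤ x + sum ys
hook+hook≤sum {x} {y ∷ zs} (y≤x ∷ _) (_ ∷ ps) (here refl) =
  subst (_≤ x + (y + sum zs)) (regroup y (length zs))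
        (+-mono-≤ y≤x (+-monoʳ-≤ y (length+length≤sum ps)))
  where
  regroup : ∀ y l → y + (y + (l + l)) ≡ y + l + (y + l)
  regroup = solve-∀
hook+hook≤sum {x} {y ∷ zs} (_ ∷ lin) (_ ∷ ps) (there c∈) =
  ≤-trans (hook+hook≤sum lin ps c∈) (m≤n+m (y + sum zs) x)

innerHooks-≤ : ∀ {x ys r} → Linked _≥_ (x ∷ ys) → All (2 ≤_) ys →
  x + sum ys + r ≤ 3 * suc r → ∀ {c} → c ∈ firstColHooks ys → c ≤ suc r
innerHooks-≤ {x} {ys} {r} lin ps total {c} c∈ with c ≤? suc r
... | yes c≤ = c≤
... | no  c≰ = ⊥-elim (<-irrefl refl (begin-strict
  3 * suc r                       <⟨ ≤-reflexive (regroup r) ⟩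
  suc (suc r) + suc (suc r) + r   ≤⟨ +-monoˡ-≤ r (+-mono-≤ (≰⇒> c≰) (≰⇒> c≰)) ⟩
  c + c + r                       ≤⟨ +-monoˡ-≤ r (hook+hook≤sum lin ps c∈) ⟩
  x + sum ys + r                  ≤⟨ total ⟩
  3 * suc r                       ∎))
  where
  open ≤-Reasoning
  regroup : ∀ r → suc (3 * suc r) ≡ suc (suc r) + suc (suc r) + r
  regroup = solve-∀

numericalSemigroup⇒splitCovered : ∀ x ys r → IsNumericalSemigroup (Sλ ((x ∷ ys) ++ replicate r 1)) →
  SplitCovered r (x + length ys) (firstColHooks ys)
numericalSemigroup⇒splitCovered x ys r (_ , closed) =
  additive⇒splitCovered r (x + length ys) (firstColHooks ys)
    (subst (λ L → ComplementAdditive (_∈ L)) (firstColHooks-padded x ys r) closed)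

padded-positive : ∀ {ν} r → All (2 ≤_) ν → All (1 ≤_) (ν ++ replicate r 1)
padded-positive r ps = All-++⁺ (All.map <⇒≤ ps) (replicate⁺ r ≤-refl)

splitCovered⇒numericalSemigroup : ∀ {x ys} r → All (2 ≤_) (x ∷ ys) →
  (∀ {c} → c ∈ firstColHooks ys → c ≤ suc r) → SplitCovered r (x + length ys) (firstColHooks ys) →
  IsNumericalSemigroup (Sλ ((x ∷ ys) ++ replicate r 1))
splitCovered⇒numericalSemigroup {x} {ys} r ps small covered =
  additive⇒numericalSemigroup (padded-positive r ps)
    (subst (λ L → ComplementAdditive (_∈ L)) (sym (firstColHooks-padded x ys r))
      (splitCovered⇒additive r (x + length ys) (firstColHooks ys) small covered))

linked-replicate : ∀ {a ℓ} {A : Set a} {R : A → A → Set ℓ} {x} → R x x → ∀ k → Linked R (replicate k x)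
linked-replicate Rxx zero          = []
linked-replicate Rxx (suc zero)    = [-]
linked-replicate Rxx (suc (suc k)) = Rxx ∷ linked-replicate Rxx (suc k)

linked-++⁻ˡ : ∀ {a ℓ} {A : Set a} {R : A → A → Set ℓ} xs {ys} → Linked R (xs ++ ys) → Linked R xs
linked-++⁻ˡ []           _         = []
linked-++⁻ˡ (x ∷ [])     _         = [-]
linked-++⁻ˡ (x ∷ y ∷ xs) (Rxy ∷ l) = Rxy ∷ linked-++⁻ˡ (y ∷ xs) l

padded-linked : ∀ {ν} r → Linked _≥_ ν → All (2 ≤_) ν → Linked _≥_ (ν ++ replicate r 1)
padded-linked         r       []        _          = linked-replicate ≤-refl r
padded-linked         zero    [-]       _          = [-]
padded-linked         (suc r) [-]       (2≤x ∷ _)  = <⇒≤ 2≤x ∷ linked-replicate ≤-refl (suc r)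
padded-linked {_ ∷ ν} r       (x≥y ∷ l) (_ ∷ ps)   = x≥y ∷ padded-linked r l ps

sum-padded : ∀ ν r → sum (ν ++ replicate r 1) ≡ sum ν + r
sum-padded ν r = trans (sum-++ ν (replicate r 1)) (cong (sum ν +_) (sum-replicate r))
  where
  sum-replicate : ∀ r → sum (replicate r 1) ≡ r
  sum-replicate zero    = refl
  sum-replicate (suc r) = cong suc (sum-replicate r)

filter-padded : ∀ {ν} r → All (2 ≤_) ν → filter (2 ≤?_) (ν ++ replicate r 1) ≡ ν
filter-padded {ν} r ps = begin
  filter (2 ≤?_) (ν ++ replicate r 1)                  ≡⟨ filter-++ (2 ≤?_) ν (replicate r 1) ⟩
  filter (2 ≤?_) ν ++ filter (2 ≤?_) (replicate r 1)   ≡⟨ cong₂ _++_ (filter-all (2 ≤?_) ps)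
                                                            (filter-none (2 ≤?_) (replicate⁺ r (<-irrefl refl))) ⟩
  ν ++ []                                              ≡⟨ ++-identityʳ ν ⟩
  ν                                                    ∎
  where open ≡-Reasoning

ones-padded : ∀ {ν} r → All (2 ≤_) ν → ones (ν ++ replicate r 1) ≡ r
ones-padded {ν} r ps = begin
  length (filter (_≟ 1) (ν ++ replicate r 1))                    ≡⟨ cong length (filter-++ (_≟ 1) ν (replicate r 1)) ⟩
  length (filter (_≟ 1) ν ++ filter (_≟ 1) (replicate r 1))      ≡⟨ cong₂ (λ xs ys → length (xs ++ ys))
                                                                      (filter-none (_≟ 1) (All.map >⇒≢ ps))
                                                                      (filter-all (_≟ 1) (replicate⁺ r refl)) ⟩
  length (replicate r 1)                                         ≡⟨ length-replicate r ⟩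
  r                                                              ∎
  where open ≡-Reasoning

split-ones : ∀ {μ} → Linked _≥_ μ → All (1 ≤_) μ → ∃₂ λ ν k → All (2 ≤_) ν × μ ≡ ν ++ replicate k 1
split-ones {[]}    _ _ = [] , 0 , [] , refl
split-ones {x ∷ μ} lin (1≤x ∷ pos) with 2 ≤? x
... | yes 2≤x with split-ones (tail lin) pos
...   | ν , k , ps , refl = x ∷ ν , k , 2≤x ∷ ps , refl
split-ones {x ∷ μ} lin (1≤x ∷ pos) | no 2≰x with ≤-antisym (≤-pred (≰⇒> 2≰x)) 1≤x
... | refl = [] , suc (length μ) , [] , cong (1 ∷_) (all-ones lin pos)
  where
  all-ones : ∀ {xs} → Linked _≥_ (1 ∷ xs) → All (1 ≤_) xs → xs ≡ replicate (length xs) 1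
  all-ones {[]}     _         _             = refl
  all-ones {y ∷ ys} (y≤1 ∷ l) (1≤y ∷ pos) with ≤-antisym y≤1 1≤y
  ... | refl = cong (1 ∷_) (all-ones l pos)

PM⇒padded : ∀ {n r μ} → PM n (suc r) μ → Σ (List ℕ) λ ν → All (2 ≤_) ν × μ ≡ ν ++ replicate r 1
PM⇒padded ((lin , pos , _) , ones≡r , _) with split-ones lin pos
... | ν , k , ps , refl = ν , ps , cong (λ i → ν ++ replicate i 1) (trans (sym (ones-padded k ps)) ones≡r)

partition-padded-sum : ∀ {n} ν r → IsPartition n (ν ++ replicate r 1) → sum ν + r ≡ n
partition-padded-sum ν r (_ , _ , sum≡n) = trans (sym (sum-padded ν r)) sum≡n

padded⇒PM : ∀ {n r ν} → All (2 ≤_) ν → Linked _≥_ ν → sum ν + r ≡ n →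
  IsNumericalSemigroup (Sλ (ν ++ replicate r 1)) → PM n (suc r) (ν ++ replicate r 1)
padded⇒PM {r = r} {ν} ps lin sum≡n sg =
  (padded-linked r lin ps , padded-positive r ps , trans (sum-padded ν r) sum≡n) , ones-padded r ps , sg

φ-padded : ∀ {ν} r → All (2 ≤_) ν → φ (suc r) (ν ++ replicate r 1) ≡ bumpFirst ν ++ replicate (suc r) 1
φ-padded r ps = cong (λ ν → bumpFirst ν ++ replicate (suc r) 1) (filter-padded r ps)

bumpFirst-injective : ∀ {xs ys} → bumpFirst xs ≡ bumpFirst ys → xs ≡ ys
bumpFirst-injective {[]}    {[]}    _    = refl
bumpFirst-injective {_ ∷ _} {_ ∷ _} refl = refl

bump-sum : ∀ s r → suc s + suc r ≡ s + r + 2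
bump-sum = solve-∀

φ-wellDefined : ∀ {n r} → suc r < n → n ≤ 3 * suc r → ∀ μ → PM n (suc r) μ → Target n (suc r) (φ (suc r) μ)
φ-wellDefined {n} {r} j<n n≤3j μ pm with PM⇒padded pm
... | [] , _ , refl = ⊥-elim (<-irrefl (partition-padded-sum [] r (proj₁ pm)) (<-trans (n<1+n r) j<n))
... | x ∷ ys , ps@(2≤x ∷ ys≥2) , refl =
  subst (Target n (suc r)) (sym (φ-padded r ps))
    (padded⇒PM bumped-ps (bumped-linked lin) (trans (bump-sum (x + sum ys) r) (cong (_+ 2) sum≡n)) sg
    , >⇒≢ (s≤s (second-part≤ lin)))
  where
  bumped-ps : All (2 ≤_) (suc x ∷ ys)
  bumped-ps = m≤n⇒m≤1+n 2≤x ∷ ys≥2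
  lin : Linked _≥_ (x ∷ ys)
  lin = linked-++⁻ˡ (x ∷ ys) (proj₁ (proj₁ pm))
  sum≡n : x + sum ys + r ≡ n
  sum≡n = partition-padded-sum (x ∷ ys) r (proj₁ pm)
  bumped-linked : ∀ {zs} → Linked _≥_ (x ∷ zs) → Linked _≥_ (suc x ∷ zs)
  bumped-linked [-]         = [-]
  bumped-linked (y≤x ∷ l)   = m≤n⇒m≤1+n y≤x ∷ l
  second-part≤ : ∀ {zs} → Linked _≥_ (x ∷ zs) → part (zs ++ replicate (suc r) 1) 0 ≤ x
  second-part≤ [-]         = <⇒≤ 2≤x
  second-part≤ (y≤x ∷ _)   = y≤x
  sg : IsNumericalSemigroup (Sλ ((suc x ∷ ys) ++ replicate (suc r) 1))
  sg = splitCovered⇒numericalSemigroup (suc r) bumped-ps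
         (m≤n⇒m≤1+n ∘ innerHooks-≤ lin ys≥2 (subst (_≤ 3 * suc r) (sym sum≡n) n≤3j))
         (splitCovered-suc (numericalSemigroup⇒splitCovered x ys r (proj₂ (proj₂ pm))))

φ-injective : ∀ {n r} μ μ′ → PM n (suc r) μ → PM n (suc r) μ′ → φ (suc r) μ ≡ φ (suc r) μ′ → μ ≡ μ′
φ-injective {r = r} μ μ′ pm pm′ φμ≡φμ′ with PM⇒padded pm | PM⇒padded pm′
... | ν , ps , refl | ν′ , ps′ , refl =
  cong (_++ replicate r 1) (bumpFirst-injective (++-cancelʳ (replicate (suc r) 1) (bumpFirst ν) (bumpFirst ν′)
    (trans (sym (φ-padded r ps)) (trans φμ≡φμ′ (φ-padded r ps′)))))

target-head≥3 : ∀ {n r X ys} → suc r < n → All (2 ≤_) (X ∷ ys) →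
  Target n (suc r) ((X ∷ ys) ++ replicate (suc r) 1) → 3 ≤ X
target-head≥3 {X = suc (suc (suc _))} _ _ _ = s≤s (s≤s (s≤s z≤n))
target-head≥3 {X = 0} _ (() ∷ _) _
target-head≥3 {X = 1} _ (s≤s () ∷ _) _
target-head≥3 {n} {r} {X = 2} {[]} j<n _ (pm , _) =
  ⊥-elim (<-irrefl (+-cancelʳ-≡ 2 (suc r) n
    (trans (+-comm (suc r) 2) (partition-padded-sum (2 ∷ []) (suc r) (proj₁ pm)))) j<n)
target-head≥3 {X = 2} {_ ∷ _} _ (_ ∷ 2≤y ∷ _) ((((y≤2 ∷ _) , _) , _) , head≢) =
  ⊥-elim (head≢ (≤-antisym 2≤y y≤2))

linked-unbump : ∀ {x ys zs} → Linked _≥_ (suc x ∷ ys) → suc x ≢ part (ys ++ zs) 0 → Linked _≥_ (x ∷ ys)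
linked-unbump [-]         _      = [-]
linked-unbump (y≤1+x ∷ l) head≢ = ≤-pred (≤∧≢⇒< y≤1+x (head≢ ∘ sym)) ∷ l

φ-surjective : ∀ {n r} → suc r < n → n ≤ 3 * suc r →
  ∀ λ′ → Target n (suc r) λ′ → ∃ λ μ → PM n (suc r) μ × φ (suc r) μ ≡ λ′
φ-surjective {n} {r} j<n n≤3j λ′ target@(pm , head≢) with PM⇒padded pm
... | [] , _ , refl = ⊥-elim (<-irrefl (partition-padded-sum [] (suc r) (proj₁ pm)) (<-≤-trans j<n (m≤m+n n 2)))
... | X ∷ ys , ps@(_ ∷ ys≥2) , refl with target-head≥3 j<n ps target
...   | s≤s {n = x} 2≤x =
  (x ∷ ys) ++ replicate r 1 , padded⇒PM (2≤x ∷ ys≥2) lin sum≡n sg , φ-padded r (2≤x ∷ ys≥2)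
  where
  lin : Linked _≥_ (x ∷ ys)
  lin = linked-unbump (linked-++⁻ˡ (suc x ∷ ys) (proj₁ (proj₁ pm))) head≢
  sum≡n : x + sum ys + r ≡ n
  sum≡n = +-cancelʳ-≡ 2 _ n
    (trans (sym (bump-sum (x + sum ys) r)) (partition-padded-sum (suc x ∷ ys) (suc r) (proj₁ pm)))
  sg : IsNumericalSemigroup (Sλ ((x ∷ ys) ++ replicate r 1))
  sg = splitCovered⇒numericalSemigroup r (2≤x ∷ ys≥2)
         (innerHooks-≤ lin ys≥2 (subst (_≤ 3 * suc r) (sym sum≡n) n≤3j))
         (splitCovered-pred (numericalSemigroup⇒splitCovered (suc x) ys (suc r) (proj₂ (proj₂ pm))))

lemma5p4 : (j n : ℕ) → 1 ≤ j → 1 ≤ n → n ≤ 3 * j → j < n →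
    (∀ μ → PM n j μ → Σ (List ℕ) (λ ν → All (2 ≤_) ν × μ ≡ ν ++ replicate (j ∸ 1) 1))
    × (∀ μ → PM n j μ → Target n j (φ j μ))
    × (∀ μ μ′ → PM n j μ → PM n j μ′ → φ j μ ≡ φ j μ′ → μ ≡ μ′)
    × (∀ λ′ → Target n j λ′ → ∃ (λ μ → PM n j μ × φ j μ ≡ λ′))
lemma5p4 (suc r) n _ _ n≤3j j<n =
  (λ _ → PM⇒padded) , φ-wellDefined j<n n≤3j , φ-injective , φ-surjective j<n n≤3j
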